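{- Let $x$ be a sequence of pairwise distinct integers of length $m$, $i\in\{1,\ldots,m-1\}$ and $y=\tau(x,i)$. For all $j\in\{1,\ldots,m\}\setminus\{i,i+1\}$: if $\overrightarrow{PD}_x[j]\notin\{j-i-1,\,j-i\}$ then $\overrightarrow{PD}_y[j]=\overrightarrow{PD}_x[j]$; and if $\overleftarrow{PD}_x[j]\notin\{i-j,\,i+1-j\}$ then $\overleftarrow{PD}_y[j]=\overleftarrow{PD}_x[j]$.
   Context: All sequences consist of pairwise distinct integers. $\tau(x,i)$ exchanges $x[i]$ and $x[i+1]$. $\overrightarrow{PD}_x[h]=h-\max\{j<h: x[j]<x[h]\}$ if such $j$ exists and $0$ otherwise; $\overleftarrow{PD}_x[h]=\min\{j>h: x[j]<x[h]\}-h$ if such $j$ exists and $0$ otherwise. -}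

module Defs where

open import Data.Nat using (ℕ; zero; suc; _+_; _∸_; _<?_; _<_; _≟_)
open import Data.Integer using (ℤ) renaming (_<_ to _<ℤ_; _<?_ to _<ℤ?_)
open import Data.Fin using (Fin; toℕ; fromℕ<)
open import Data.Maybe using (Maybe; just; nothing)
open import Relation.Nullary using (yes; no)
open import Function.Definitions using (Injective)
open import Relation.Binary.PropositionalEquality using (_≡_)

-- A sequence of length m is a function Fin m → ℤ; positions are 0-indexed
-- (positions 0..m-1 correspond to the paper's 1..m; all quantities
-- below are differences of positions, hence unaffected by the shift).
Seq : ℕ → Set
Seq m = Fin m → ℤ

Distinct : ∀ {m} → Seq m → Set
Distinct x = Injective _≡_ _≡_ x

at : ∀ {m} → Seq m → ℕ → Maybe ℤ
at {m} x j with j <? m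
... | yes p = just (x (fromℕ< p))
... | no _  = nothing

maxLess : ∀ {m} → Seq m → ℤ → ℕ → Maybe ℕ
maxLess x v zero = nothing
maxLess x v (suc n) with at x n
... | nothing = maxLess x v n
... | just a with a <ℤ? v
...   | yes _ = just n
...   | no _  = maxLess x v n

minLess : ∀ {m} → Seq m → ℤ → ℕ → ℕ → Maybe ℕ
minLess x v lo zero = nothing
minLess x v lo (suc k) with at x lo
... | nothing = minLess x v (suc lo) k
... | just a with a <ℤ? v
...   | yes _ = just lo
...   | no _  = minLess x v (suc lo) k

-- →PD_x[h] = h - max{ j < h : x[j] < x[h] }, or 0 if no such j
PDright : ∀ {m} → Seq m → Fin m → ℕ
PDright x h with maxLess x (x h) (toℕ h)
... | just j  = toℕ h ∸ j
... | nothing = 0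

-- ←PD_x[h] = min{ j > h : x[j] < x[h] } - h, or 0 if no such j
PDleft : ∀ {m} → Seq m → Fin m → ℕ
PDleft {m} x h with minLess x (x h) (suc (toℕ h)) (m ∸ suc (toℕ h))
... | just j  = j ∸ toℕ h
... | nothing = 0

τ : ∀ {m} → Seq m → (i : ℕ) → suc i < m → Seq m
τ x i p k with toℕ k ≟ i | toℕ k ≟ suc i
... | yes _ | _     = x (fromℕ< p)
... | no _  | yes _ = x (fromℕ< (Data.Nat.Properties.<-trans (Data.Nat.Properties.n<1+n i) p))
  where import Data.Nat.Properties
... | no _  | no _  = x k

{-# OPTIONS --safe #-}
module Submission where

-- Both PD values are read off a search for the nearest position on one side of j holding a
-- value below x[j]; τ(x,i) keeps x[j] and only exchanges the entries at i and i+1. If both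
-- of these lie outside the search range nothing changes; if both lie inside it, exchanging
-- two adjacent entries can only change the result of the search when that result is i or
-- i+1, and these are exactly the cases excluded by the hypotheses on the PD value.

open import Defs
open import Data.Bool using (Bool; true; false; if_then_else_)
open import Data.Fin using (Fin; toℕ; fromℕ<)
open import Data.Fin.Properties using (toℕ-fromℕ<; toℕ<n)
open import Data.Integer using (ℤ; +_; _-_) renaming (_<?_ to _<ℤ?_)
open import Data.Integer.Properties using (m-n≡m⊖n; ⊖-≥)
open import Data.Maybe using (Maybe; just; nothing)
open import Data.Nat using (ℕ; zero; suc; _+_; _∸_; _≤_; _<_; _≟_; _<?_; s≤s⁻¹)
open import Data.Nat.Properties
open import Data.Product using (_×_; _,_)
open import Data.Sum using (_⊎_; inj₁; inj₂)
open import Function using (_∘_)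
open import Relation.Binary.Definitions using (tri<; tri≈; tri>)
open import Relation.Binary.PropositionalEquality
open import Relation.Nullary using (yes; no; does)
open import Relation.Nullary.Negation using (contradiction)

record Transposed {A : Set} (f g : ℕ → A) (i : ℕ) : Set where
  field
    elsewhere : ∀ k → k ≢ i → k ≢ suc i → g k ≡ f k
    at-i      : g i ≡ f (suc i)
    at-suc-i  : g (suc i) ≡ f i

module _ {A : Set} (P : A → Bool) where

  step : ℕ → A → Maybe ℕ → Maybe ℕ
  step n a r = if P a then just n else r

  lastWhere : (ℕ → A) → ℕ → Maybe ℕ
  lastWhere f zero    = nothing
  lastWhere f (suc n) = step n (f n) (lastWhere f n)

  firstWhere : (ℕ → A) → ℕ → ℕ → Maybe ℕ
  firstWhere f lo zero    = nothing
  firstWhere f lo (suc k) = step lo (f lo) (firstWhere f (suc lo) k)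

  step-comm : ∀ p q a b r → step p a (step q b r) ≢ just p → step p a (step q b r) ≢ just q →
              step p b (step q a r) ≡ step p a (step q b r)
  step-comm p q a b r ≢p ≢q with P a | P b
  ... | true  | _     = contradiction refl ≢p
  ... | false | true  = contradiction refl ≢q
  ... | false | false = refl

  step-congʳ : ∀ n a {r r′} → (step n a r′ ≡ r′ → r ≡ r′) → step n a r ≡ step n a r′
  step-congʳ n a r≡r′ with P a
  ... | true  = refl
  ... | false = r≡r′ refl

  lastWhere-local : ∀ {f g} n → (∀ k → k < n → g k ≡ f k) → lastWhere g n ≡ lastWhere f n
  lastWhere-local zero    g≡f = refl
  lastWhere-local (suc n) g≡f =
    cong₂ (step n) (g≡f n ≤-refl) (lastWhere-local n (λ k k<n → g≡f k (m<n⇒m<1+n k<n)))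

  firstWhere-local : ∀ {f g} lo k → (∀ t → lo ≤ t → g t ≡ f t) → firstWhere g lo k ≡ firstWhere f lo k
  firstWhere-local lo zero    g≡f = refl
  firstWhere-local lo (suc k) g≡f =
    cong₂ (step lo) (g≡f lo ≤-refl) (firstWhere-local (suc lo) k (λ t lo<t → g≡f t (<⇒≤ lo<t)))

  lastWhere-transpose : ∀ {f g i} → Transposed f g i → ∀ n → suc (suc i) ≤ n →
                        lastWhere f n ≢ just i → lastWhere f n ≢ just (suc i) → lastWhere g n ≡ lastWhere f n
  lastWhere-transpose {f} {g} {i} T (suc n) 2+i≤1+n ≢i ≢1+i with n ≟ suc i
  ... | yes refl
    rewrite Transposed.at-suc-i T | Transposed.at-i T
          | lastWhere-local i (λ k k<i → Transposed.elsewhere T k (<⇒≢ k<i) (<⇒≢ (m<n⇒m<1+n k<i)))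
    = step-comm (suc i) i (f (suc i)) (f i) (lastWhere f i) ≢1+i ≢i
  ... | no n≢1+i = trans (cong (λ a → step n a (lastWhere g n)) g≡f)
                         (step-congʳ n (f n) (λ e → lastWhere-transpose T n 2+i≤n (≢i ∘ trans e) (≢1+i ∘ trans e)))
    where
    2+i≤n : suc (suc i) ≤ n
    2+i≤n = ≤∧≢⇒< (s≤s⁻¹ 2+i≤1+n) (n≢1+i ∘ sym)
    g≡f : g n ≡ f n
    g≡f = Transposed.elsewhere T n (>⇒≢ (<-trans (n<1+n i) 2+i≤n)) n≢1+i

  firstWhere-transpose : ∀ {f g i} → Transposed f g i → ∀ lo k → lo ≤ i → suc (suc i) ≤ lo + k →
                         firstWhere f lo k ≢ just i → firstWhere f lo k ≢ just (suc i) →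
                         firstWhere g lo k ≡ firstWhere f lo k
  firstWhere-transpose T lo zero _ _ _ _ = refl
  firstWhere-transpose {f} {g} {i} T lo (suc k) lo≤i 2+i≤lo+1+k ≢i ≢1+i with lo ≟ i
  firstWhere-transpose T lo (suc zero) lo≤i 2+i≤lo+1 ≢i ≢1+i | yes refl =
    contradiction (subst (suc (suc lo) ≤_) (+-comm lo 1) 2+i≤lo+1) 1+n≰n
  firstWhere-transpose {f} {g} {i} T i (suc (suc k)) _ _ ≢i ≢1+i | yes refl
    rewrite Transposed.at-i T | Transposed.at-suc-i T
          | firstWhere-local (suc (suc i)) k
              (λ t 2+i≤t → Transposed.elsewhere T t (>⇒≢ (<-trans (n<1+n i) 2+i≤t)) (>⇒≢ 2+i≤t))
    = step-comm i (suc i) (f i) (f (suc i)) (firstWhere f (suc (suc i)) k) ≢i ≢1+i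
  ... | no lo≢i = trans (cong (λ a → step lo a (firstWhere g (suc lo) k)) g≡f)
                        (step-congʳ lo (f lo) (λ e → firstWhere-transpose T (suc lo) k (≤∧≢⇒< lo≤i lo≢i)
                          (subst (suc (suc i) ≤_) (+-suc lo k) 2+i≤lo+1+k) (≢i ∘ trans e) (≢1+i ∘ trans e)))
    where
    g≡f : g lo ≡ f lo
    g≡f = Transposed.elsewhere T lo lo≢i (<⇒≢ (m<n⇒m<1+n (≤∧≢⇒< lo≤i lo≢i)))

below : ℤ → Maybe ℤ → Bool
below v nothing  = false
below v (just a) = does (a <ℤ? v)

maxLess≡lastWhere : ∀ {m} (x : Seq m) v n → maxLess x v n ≡ lastWhere (below v) (at x) n
maxLess≡lastWhere x v zero = refl
maxLess≡lastWhere x v (suc n) with at x n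
... | nothing = maxLess≡lastWhere x v n
... | just a with a <ℤ? v
...   | yes _ = refl
...   | no _  = maxLess≡lastWhere x v n

minLess≡firstWhere : ∀ {m} (x : Seq m) v lo k → minLess x v lo k ≡ firstWhere (below v) (at x) lo k
minLess≡firstWhere x v lo zero = refl
minLess≡firstWhere x v lo (suc k) with at x lo
... | nothing = minLess≡firstWhere x v (suc lo) k
... | just a with a <ℤ? v
...   | yes _ = refl
...   | no _  = minLess≡firstWhere x v (suc lo) k

at-fromℕ< : ∀ {m} (x : Seq m) {n} (n<m : n < m) → at x n ≡ just (x (fromℕ< n<m))
at-fromℕ< {m} x {n} n<m with n <? m
... | yes _   = refl  -- the proof argument of fromℕ< is irrelevant
... | no n≮m  = contradiction n<m n≮m

PDright-cong : ∀ {m} {x y : Seq m} h → y h ≡ x h →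
               maxLess y (x h) (toℕ h) ≡ maxLess x (x h) (toℕ h) → PDright y h ≡ PDright x h
PDright-cong h yh≡xh eq rewrite yh≡xh | eq = refl

PDleft-cong : ∀ {m} {x y : Seq m} h → y h ≡ x h →
              minLess y (x h) (suc (toℕ h)) (m ∸ suc (toℕ h)) ≡ minLess x (x h) (suc (toℕ h)) (m ∸ suc (toℕ h)) →
              PDleft y h ≡ PDleft x h
PDleft-cong h yh≡xh eq rewrite yh≡xh | eq = refl

PDright-just : ∀ {m} (x : Seq m) h {k} → maxLess x (x h) (toℕ h) ≡ just k → PDright x h ≡ toℕ h ∸ k
PDright-just x h eq rewrite eq = refl

PDleft-just : ∀ {m} (x : Seq m) h {k} → minLess x (x h) (suc (toℕ h)) (m ∸ suc (toℕ h)) ≡ just k →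
              PDleft x h ≡ k ∸ toℕ h
PDleft-just x h eq rewrite eq = refl

+[m∸n]≡+m-+n : ∀ {m n} → n ≤ m → + (m ∸ n) ≡ + m - + n
+[m∸n]≡+m-+n {m} {n} n≤m = sym (trans (m-n≡m⊖n m n) (⊖-≥ n≤m))

+[m∸1+n]≡+m-+n-1 : ∀ {m n} → suc n ≤ m → + (m ∸ suc n) ≡ + m - + n - + 1
+[m∸1+n]≡+m-+n-1 {m} {n} 1+n≤m = begin
  + (m ∸ suc n)     ≡⟨ cong (λ k → + (m ∸ k)) (+-comm 1 n) ⟩
  + (m ∸ (n + 1))   ≡⟨ cong +_ (∸-+-assoc m n 1) ⟨
  + (m ∸ n ∸ 1)     ≡⟨ +[m∸n]≡+m-+n (m<n⇒0<n∸m 1+n≤m) ⟩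
  + (m ∸ n) - + 1   ≡⟨ cong (_- + 1) (+[m∸n]≡+m-+n (<⇒≤ 1+n≤m)) ⟩
  + m - + n - + 1   ∎
  where open ≡-Reasoning

≢∧≢1+⇒<⊎> : ∀ {j i} → j ≢ i → j ≢ suc i → j < i ⊎ suc i < j
≢∧≢1+⇒<⊎> {j} {i} j≢i j≢1+i with <-cmp j i
... | tri< j<i _ _ = inj₁ j<i
... | tri≈ _ j≡i _ = contradiction j≡i j≢i
... | tri> _ _ i<j = inj₂ (≤∧≢⇒< i<j (j≢1+i ∘ sym))

module _ {m} (x : Seq m) (i : ℕ) (1+i<m : suc i < m) where

  private
    i<m : i < m
    i<m = <-trans (n<1+n i) 1+i<m

  τ-elsewhere : ∀ k → toℕ k ≢ i → toℕ k ≢ suc i → τ x i 1+i<m k ≡ x k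
  τ-elsewhere k k≢i k≢1+i with toℕ k ≟ i | toℕ k ≟ suc i
  ... | yes k≡i | _         = contradiction k≡i k≢i
  ... | no _    | yes k≡1+i = contradiction k≡1+i k≢1+i
  ... | no _    | no _      = refl

  τ-at-i : ∀ k → toℕ k ≡ i → τ x i 1+i<m k ≡ x (fromℕ< 1+i<m)
  τ-at-i k k≡i with toℕ k ≟ i
  ... | yes _   = refl
  ... | no k≢i  = contradiction k≡i k≢i

  τ-at-suc-i : ∀ k → toℕ k ≡ suc i → τ x i 1+i<m k ≡ x (fromℕ< i<m)
  τ-at-suc-i k k≡1+i with toℕ k ≟ i | toℕ k ≟ suc i
  ... | yes k≡i | _        = contradiction (trans (sym k≡i) k≡1+i) (<⇒≢ (n<1+n i))
  ... | no _    | yes _    = refl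
  ... | no _    | no k≢1+i = contradiction k≡1+i k≢1+i

  at-τ : Transposed (at x) (at (τ x i 1+i<m)) i
  Transposed.elsewhere at-τ k k≢i k≢1+i with k <? m
  ... | yes k<m = cong just (τ-elsewhere (fromℕ< k<m) (k≢i ∘ trans (sym (toℕ-fromℕ< k<m)))
                                                      (k≢1+i ∘ trans (sym (toℕ-fromℕ< k<m))))
  ... | no _    = refl
  Transposed.at-i at-τ = begin
    at (τ x i 1+i<m) i              ≡⟨ at-fromℕ< _ i<m ⟩
    just (τ x i 1+i<m (fromℕ< i<m)) ≡⟨ cong just (τ-at-i _ (toℕ-fromℕ< i<m)) ⟩
    just (x (fromℕ< 1+i<m))         ≡⟨ at-fromℕ< x 1+i<m ⟨
    at x (suc i)                    ∎
    where open ≡-Reasoning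
  Transposed.at-suc-i at-τ = begin
    at (τ x i 1+i<m) (suc i)          ≡⟨ at-fromℕ< _ 1+i<m ⟩
    just (τ x i 1+i<m (fromℕ< 1+i<m)) ≡⟨ cong just (τ-at-suc-i _ (toℕ-fromℕ< 1+i<m)) ⟩
    just (x (fromℕ< i<m))             ≡⟨ at-fromℕ< x i<m ⟨
    at x i                            ∎
    where open ≡-Reasoning

  untouched-below : ∀ n → n ≤ i → ∀ k → k < n → at (τ x i 1+i<m) k ≡ at x k
  untouched-below n n≤i k k<n =
    Transposed.elsewhere at-τ k (<⇒≢ (≤-trans k<n n≤i)) (<⇒≢ (≤-trans k<n (m≤n⇒m≤1+n n≤i)))

  untouched-above : ∀ lo → suc (suc i) ≤ lo → ∀ k → lo ≤ k → at (τ x i 1+i<m) k ≡ at x k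
  untouched-above lo 2+i≤lo k lo≤k =
    Transposed.elsewhere at-τ k (>⇒≢ (≤-trans (<⇒≤ 2+i≤lo) lo≤k)) (>⇒≢ (≤-trans 2+i≤lo lo≤k))

  maxLess-τ-≤ : ∀ v n → n ≤ i → maxLess (τ x i 1+i<m) v n ≡ maxLess x v n
  maxLess-τ-≤ v n n≤i
    rewrite maxLess≡lastWhere (τ x i 1+i<m) v n | maxLess≡lastWhere x v n
    = lastWhere-local (below v) n (untouched-below n n≤i)

  maxLess-τ-≥ : ∀ v n → suc (suc i) ≤ n → maxLess x v n ≢ just i → maxLess x v n ≢ just (suc i) →
                maxLess (τ x i 1+i<m) v n ≡ maxLess x v n
  maxLess-τ-≥ v n 2+i≤n ≢i ≢1+i
    rewrite maxLess≡lastWhere (τ x i 1+i<m) v n | maxLess≡lastWhere x v n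
    = lastWhere-transpose (below v) at-τ n 2+i≤n ≢i ≢1+i

  minLess-τ-≥ : ∀ v lo k → suc (suc i) ≤ lo → minLess (τ x i 1+i<m) v lo k ≡ minLess x v lo k
  minLess-τ-≥ v lo k 2+i≤lo
    rewrite minLess≡firstWhere (τ x i 1+i<m) v lo k | minLess≡firstWhere x v lo k
    = firstWhere-local (below v) lo k (untouched-above lo 2+i≤lo)

  minLess-τ-≤ : ∀ v lo k → lo ≤ i → suc (suc i) ≤ lo + k →
                minLess x v lo k ≢ just i → minLess x v lo k ≢ just (suc i) →
                minLess (τ x i 1+i<m) v lo k ≡ minLess x v lo k
  minLess-τ-≤ v lo k lo≤i 2+i≤lo+k ≢i ≢1+i
    rewrite minLess≡firstWhere (τ x i 1+i<m) v lo k | minLess≡firstWhere x v lo k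
    = firstWhere-transpose (below v) at-τ lo k lo≤i 2+i≤lo+k ≢i ≢1+i

  PDright-τ : ∀ j → toℕ j ≢ i → toℕ j ≢ suc i →
              + PDright x j ≢ + toℕ j - + i - + 1 → + PDright x j ≢ + toℕ j - + i →
              PDright (τ x i 1+i<m) j ≡ PDright x j
  PDright-τ j j≢i j≢1+i ≢j-i-1 ≢j-i =
    PDright-cong j (τ-elsewhere j j≢i j≢1+i) (searches-agree (≢∧≢1+⇒<⊎> j≢i j≢1+i))
    where
    searches-agree : toℕ j < i ⊎ suc i < toℕ j →
                     maxLess (τ x i 1+i<m) (x j) (toℕ j) ≡ maxLess x (x j) (toℕ j)
    searches-agree (inj₁ j<i)   = maxLess-τ-≤ (x j) (toℕ j) (<⇒≤ j<i)
    searches-agree (inj₂ 1+i<j) = maxLess-τ-≥ (x j) (toℕ j) 1+i<j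
      (λ e → ≢j-i (trans (cong +_ (PDright-just x j e)) (+[m∸n]≡+m-+n (<⇒≤ (<⇒≤ 1+i<j)))))
      (λ e → ≢j-i-1 (trans (cong +_ (PDright-just x j e)) (+[m∸1+n]≡+m-+n-1 (<⇒≤ 1+i<j))))

  PDleft-τ : ∀ j → toℕ j ≢ i → toℕ j ≢ suc i →
             + PDleft x j ≢ + i - + toℕ j → + PDleft x j ≢ + suc i - + toℕ j →
             PDleft (τ x i 1+i<m) j ≡ PDleft x j
  PDleft-τ j j≢i j≢1+i ≢i-j ≢1+i-j =
    PDleft-cong j (τ-elsewhere j j≢i j≢1+i) (searches-agree (≢∧≢1+⇒<⊎> j≢i j≢1+i))
    where
    searches-agree : toℕ j < i ⊎ suc i < toℕ j →
                     minLess (τ x i 1+i<m) (x j) (suc (toℕ j)) (m ∸ suc (toℕ j)) ≡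
                     minLess x (x j) (suc (toℕ j)) (m ∸ suc (toℕ j))
    searches-agree (inj₁ j<i)   = minLess-τ-≤ (x j) (suc (toℕ j)) (m ∸ suc (toℕ j)) j<i
      (subst (suc (suc i) ≤_) (sym (m+[n∸m]≡n (toℕ<n j))) 1+i<m)
      (λ e → ≢i-j (trans (cong +_ (PDleft-just x j e)) (+[m∸n]≡+m-+n (<⇒≤ j<i))))
      (λ e → ≢1+i-j (trans (cong +_ (PDleft-just x j e)) (+[m∸n]≡+m-+n (m≤n⇒m≤1+n (<⇒≤ j<i)))))
    searches-agree (inj₂ 1+i<j) = minLess-τ-≥ (x j) (suc (toℕ j)) (m ∸ suc (toℕ j)) (m≤n⇒m≤1+n 1+i<j)

lemma7 : ∀ (m : ℕ) (x : Seq m) → Distinct x → (i : ℕ) (p : suc i < m) → (j : Fin m) →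
    toℕ j ≢ i → toℕ j ≢ suc i →
      (((+ PDright x j) ≢ (+ toℕ j - + i - + 1)) → ((+ PDright x j) ≢ (+ toℕ j - + i)) → PDright (τ x i p) j ≡ PDright x j)
      × (((+ PDleft x j) ≢ (+ i - + toℕ j)) → ((+ PDleft x j) ≢ (+ suc i - + toℕ j)) → PDleft (τ x i p) j ≡ PDleft x j)
lemma7 m x _ i p j j≢i j≢1+i = PDright-τ x i p j j≢i j≢1+i , PDleft-τ x i p j j≢i j≢1+i
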